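{- For every $n\geq 3$, the dihedral group $D_n\leq\mathrm{Sym}(n)$ has the strict EKR property.
   Context: $D_n$ is the group of symmetries (rotations and reflections) of a regular $n$-gon, acting naturally on its $n$ vertices $\{1,\dots,n\}$. Two permutations $\pi,\tau\in G$ intersect if $\pi\tau^{ -1}$ has a fixed point; a subset is intersecting if every pair of its elements intersect. A permutation group $G$ has the EKR property if every intersecting subset has size at most the size of the largest point-stabilizer; it has the strict EKR property if in addition the only intersecting subsets of maximum size are the cosets of the point-stabilizers. -}

module Defs where

open import Data.Bool using (Bool; true; false)
open import Data.Nat using (ℕ; zero; suc; _+_; _∸_; _≤_; _⊔_)
open import Data.Nat.DivMod using (_mod_)
open import Data.Fin using (Fin; toℕ; _≟_)
open import Data.Fin.Properties using () renaming (_≟_ to _≟F_)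
open import Data.List using (List; _++_; map; length; filter; foldr; allFin)
open import Data.List.Membership.Propositional using (_∈_)
open import Data.List.Relation.Unary.Unique.Propositional using (Unique)
open import Data.Product using (Σ; _×_; _,_; ∃; ∃-syntax)
open import Relation.Binary.PropositionalEquality using (_≡_)
open import Function.Bundles using (_⇔_)

-- Arithmetic in ℤ/nℤ, vertices of the regular n-gon labelled by Fin n
-- (labels 0,…,n-1 in cyclic order).
_⊕_ : ∀ {n} → Fin n → Fin n → Fin n
_⊕_ {suc m} x y = (toℕ x + toℕ y) mod suc m

⊖_ : ∀ {n} → Fin n → Fin n
⊖_ {suc m} x = (suc m ∸ toℕ x) mod suc m

_⊝_ : ∀ {n} → Fin n → Fin n → Fin n
x ⊝ y = x ⊕ (⊖ y)

-- Elements of the dihedral group D_n (order 2n):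
--   (false , k) is the rotation   x ↦ x + k
--   (true  , k) is the reflection x ↦ k - x
Dih : ℕ → Set
Dih n = Bool × Fin n

act : ∀ {n} → Dih n → Fin n → Fin n
act (false , k) x = x ⊕ k
act (true  , k) x = k ⊝ x

inv : ∀ {n} → Dih n → Dih n
inv (false , k) = (false , ⊖ k)
inv (true  , k) = (true  , k)

allDih : (n : ℕ) → List (Dih n)
allDih n = map (false ,_) (allFin n) ++ map (true ,_) (allFin n)

Intersect : ∀ {n} → Dih n → Dih n → Set
Intersect π τ = ∃[ i ] act π (act (inv τ) i) ≡ i

-- a (duplicate-free list representing a) subset of D_n is intersecting
Intersecting : ∀ {n} → List (Dih n) → Set
Intersecting F = ∀ π τ → π ∈ F → τ ∈ F → Intersect π τ

stabSize : ∀ {n} → Fin n → ℕ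
stabSize {n} i = length (filter (λ g → act g i ≟F i) (allDih n))

maxStab : ℕ → ℕ
maxStab n = foldr _⊔_ 0 (map stabSize (allFin n))

InCoset : ∀ {n} → Dih n → Fin n → Dih n → Set
InCoset σ i g = Σ _ λ h → (act h i ≡ i) × (∀ x → act g x ≡ act σ (act h x))

IsStabCoset : ∀ {n} → List (Dih n) → Set
IsStabCoset {n} F = Σ (Dih n) λ σ → Σ (Fin n) λ i → ∀ g → (g ∈ F) ⇔ InCoset σ i g

EKR : ℕ → Set
EKR n = ∀ (F : List (Dih n)) → Unique F → Intersecting F → length F ≤ maxStab n

StrictEKR : ℕ → Set
StrictEKR n = EKR n ×
  (∀ (F : List (Dih n)) → Unique F → Intersecting F → length F ≡ maxStab n → IsStabCoset F)

-- An element of D_n is a rotation or a reflection, and within each kind it is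
-- determined by the image of a single vertex. Hence two distinct elements of the
-- same kind never intersect, so an intersecting set contains at most one rotation
-- and one reflection, while the stabilizer of vertex 0 already contains the
-- identity and the reflection x ↦ -x. An intersecting pair {g , h} agrees at some
-- vertex j, so it is exactly the set of elements sending j to g j, i.e. the coset
-- g G_j. Here D_n is the abstract group Bool × ℤ/n, so the argument works for
-- every n ≥ 1.

module Submission where

open import Algebra.Bundles using (AbelianGroup)
open import Algebra.Structures using (IsAbelianGroup)
import Algebra.Properties.AbelianGroup as AbelianGroupProperties
import Algebra.Properties.CommutativeSemigroup as CommutativeSemigroupProperties
open import Data.Bool using (Bool; true; false)
import Data.Bool as Bool
open import Data.Bool.Properties using (¬-not)
open import Data.Empty using (⊥; ⊥-elim)
open import Data.Nat using (ℕ; suc; _+_; _∸_; _%_; _⊔_; _≤_; z≤n; s≤s)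
open import Data.Nat.DivMod using (_mod_; %-distribˡ-+; m%n%n≡m%n; m%n<n; n%n≡0; m<n⇒m%n≡m)
import Data.Nat.Properties as ℕ
open import Data.Fin using (Fin; zero; toℕ; _≟_)
import Data.Fin as Fin
open import Data.Fin.Properties using (toℕ-fromℕ<; toℕ-injective; toℕ<n)
open import Data.List using (List; []; _∷_; length; filter; foldr; map; tabulate)
open import Data.List.Properties using (filter-accept; filter-some)
open import Data.List.Relation.Unary.All using (_∷_)
open import Data.List.Relation.Unary.Any using (Any; here; there)
open import Data.List.Relation.Unary.Unique.Propositional using (Unique; _∷_)
open import Data.List.Membership.Propositional using (_∈_; lose)
open import Data.List.Membership.Propositional.Properties using (∈-++⁺ʳ)
open import Data.Product using (proj₁; _,_; ∃-syntax)
open import Data.Sum using (_⊎_; inj₁; inj₂)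
open import Function using (_∘_)
open import Function.Bundles using (_⇔_; mk⇔)
import Function.Properties.Equivalence as ⇔
open import Relation.Nullary using (yes; no)
open import Relation.Unary using (Pred; Decidable)
open import Level using (0ℓ)
open import Relation.Binary.PropositionalEquality

open import Defs

module _ {m : ℕ} where
  private
    n : ℕ
    n = suc m

  toℕ-⊕ : (x y : Fin n) → toℕ (x ⊕ y) ≡ (toℕ x + toℕ y) % n
  toℕ-⊕ x y = toℕ-fromℕ< (m%n<n (toℕ x + toℕ y) n)

  toℕ-⊖ : (x : Fin n) → toℕ (⊖ x) ≡ (n ∸ toℕ x) % n
  toℕ-⊖ x = toℕ-fromℕ< (m%n<n (n ∸ toℕ x) n)

  [a%n+b]%n≡[a+b]%n : ∀ a b → (a % n + b) % n ≡ (a + b) % n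
  [a%n+b]%n≡[a+b]%n a b = begin
    (a % n + b) % n           ≡⟨ %-distribˡ-+ (a % n) b n ⟩
    (a % n % n + b % n) % n   ≡⟨ cong (λ t → (t + b % n) % n) (m%n%n≡m%n a n) ⟩
    (a % n + b % n) % n       ≡⟨ %-distribˡ-+ a b n ⟨
    (a + b) % n               ∎
    where open ≡-Reasoning

  [a+b%n]%n≡[a+b]%n : ∀ a b → (a + b % n) % n ≡ (a + b) % n
  [a+b%n]%n≡[a+b]%n a b = begin
    (a + b % n) % n   ≡⟨ cong (_% n) (ℕ.+-comm a (b % n)) ⟩
    (b % n + a) % n   ≡⟨ [a%n+b]%n≡[a+b]%n b a ⟩
    (b + a) % n       ≡⟨ cong (_% n) (ℕ.+-comm b a) ⟩
    (a + b) % n       ∎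
    where open ≡-Reasoning

  ⊕-assoc : (x y z : Fin n) → (x ⊕ y) ⊕ z ≡ x ⊕ (y ⊕ z)
  ⊕-assoc x y z = toℕ-injective (begin
    toℕ ((x ⊕ y) ⊕ z)                 ≡⟨ toℕ-⊕ (x ⊕ y) z ⟩
    (toℕ (x ⊕ y) + toℕ z) % n         ≡⟨ cong (λ t → (t + toℕ z) % n) (toℕ-⊕ x y) ⟩
    ((toℕ x + toℕ y) % n + toℕ z) % n ≡⟨ [a%n+b]%n≡[a+b]%n (toℕ x + toℕ y) (toℕ z) ⟩
    (toℕ x + toℕ y + toℕ z) % n       ≡⟨ cong (_% n) (ℕ.+-assoc (toℕ x) (toℕ y) (toℕ z)) ⟩
    (toℕ x + (toℕ y + toℕ z)) % n     ≡⟨ [a+b%n]%n≡[a+b]%n (toℕ x) (toℕ y + toℕ z) ⟨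
    (toℕ x + (toℕ y + toℕ z) % n) % n ≡⟨ cong (λ t → (toℕ x + t) % n) (toℕ-⊕ y z) ⟨
    (toℕ x + toℕ (y ⊕ z)) % n         ≡⟨ toℕ-⊕ x (y ⊕ z) ⟨
    toℕ (x ⊕ (y ⊕ z))                 ∎)
    where open ≡-Reasoning

  ⊕-comm : (x y : Fin n) → x ⊕ y ≡ y ⊕ x
  ⊕-comm x y = cong (_mod n) (ℕ.+-comm (toℕ x) (toℕ y))

  ⊕-identityʳ : (x : Fin n) → x ⊕ zero ≡ x
  ⊕-identityʳ x = toℕ-injective (begin
    toℕ (x ⊕ zero)      ≡⟨ toℕ-⊕ x zero ⟩
    (toℕ x + 0) % n     ≡⟨ cong (_% n) (ℕ.+-identityʳ (toℕ x)) ⟩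
    toℕ x % n           ≡⟨ m<n⇒m%n≡m (toℕ<n x) ⟩
    toℕ x               ∎)
    where open ≡-Reasoning

  ⊕-inverseʳ : (x : Fin n) → x ⊕ (⊖ x) ≡ zero
  ⊕-inverseʳ x = toℕ-injective (begin
    toℕ (x ⊕ (⊖ x))                 ≡⟨ toℕ-⊕ x (⊖ x) ⟩
    (toℕ x + toℕ (⊖ x)) % n         ≡⟨ cong (λ t → (toℕ x + t) % n) (toℕ-⊖ x) ⟩
    (toℕ x + (n ∸ toℕ x) % n) % n   ≡⟨ [a+b%n]%n≡[a+b]%n (toℕ x) (n ∸ toℕ x) ⟩
    (toℕ x + (n ∸ toℕ x)) % n       ≡⟨ cong (_% n) (ℕ.m+[n∸m]≡n (ℕ.<⇒≤ (toℕ<n x))) ⟩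
    n % n                           ≡⟨ n%n≡0 n ⟩
    0                               ∎)
    where open ≡-Reasoning

  ⊕-isAbelianGroup : IsAbelianGroup _≡_ (_⊕_ {n}) zero ⊖_
  ⊕-isAbelianGroup = record
    { isGroup = record
      { isMonoid = record
        { isSemigroup = record
          { isMagma = record { isEquivalence = isEquivalence ; ∙-cong = cong₂ _⊕_ }
          ; assoc = ⊕-assoc
          }
        ; identity = (λ x → trans (⊕-comm zero x) (⊕-identityʳ x)) , ⊕-identityʳ
        }
      ; inverse = (λ x → trans (⊕-comm (⊖ x) x) (⊕-inverseʳ x)) , ⊕-inverseʳ
      ; ⁻¹-cong = cong ⊖_
      }
    ; comm = ⊕-comm
    }

⊕-abelianGroup : ℕ → AbelianGroup 0ℓ 0ℓ
⊕-abelianGroup m = record { isAbelianGroup = ⊕-isAbelianGroup {m} }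

≢-Bool⇒≡⊎≡ : ∀ {x y : Bool} → x ≢ y → ∀ z → z ≡ x ⊎ z ≡ y
≢-Bool⇒≡⊎≡ {x} x≢y z with z Bool.≟ x
... | yes z≡x = inj₁ z≡x
... | no  z≢x = inj₂ (trans (¬-not z≢x) (sym (¬-not (x≢y ∘ sym))))

no-three-distinct-Bool : ∀ {x y z : Bool} → x ≢ y → x ≢ z → y ≢ z → ⊥
no-three-distinct-Bool {z = z} x≢y x≢z y≢z with ≢-Bool⇒≡⊎≡ x≢y z
... | inj₁ z≡x = x≢z (sym z≡x)
... | inj₂ z≡y = y≢z (sym z≡y)

2≤length-filter : ∀ {a p} {A : Set a} {P : Pred A p} (P? : Decidable P) {x : A} {xs : List A} →
                  P x → Any P xs → 2 ≤ length (filter P? (x ∷ xs))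
2≤length-filter P? {x} {xs} px pxs rewrite filter-accept P? {x} {xs} px = s≤s (filter-some P? pxs)

_·_ : ∀ {n} → Dih n → Dih n → Dih n
(false , a) · (false , b) = false , b ⊕ a
(false , a) · (true  , b) = true  , b ⊕ a
(true  , a) · (false , b) = true  , a ⊝ b
(true  , a) · (true  , b) = false , a ⊝ b

module _ {m : ℕ} where
  private
    n : ℕ
    n = suc m

  open AbelianGroup (⊕-abelianGroup m) using (assoc; comm)
  open AbelianGroupProperties (⊕-abelianGroup m)
  open CommutativeSemigroupProperties (AbelianGroup.commutativeSemigroup (⊕-abelianGroup m))
    using (xy∙z≈xz∙y; x∙yz≈y∙xz)

  ⊝-involutive : (k x : Fin n) → k ⊝ (k ⊝ x) ≡ x
  ⊝-involutive k x = begin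
    k ⊕ (⊖ (k ⊝ x))   ≡⟨ cong (k ⊕_) (⁻¹-anti-homo‿- k x) ⟩
    k ⊕ (x ⊝ k)       ≡⟨ assoc k x (⊖ k) ⟨
    (k ⊕ x) ⊝ k       ≡⟨ xyx⁻¹≈y k x ⟩
    x                 ∎
    where open ≡-Reasoning

  act-inverseˡ : (g : Dih n) (x : Fin n) → act (inv g) (act g x) ≡ x
  act-inverseˡ (false , k) x = //-rightDividesʳ k x
  act-inverseˡ (true  , k) x = ⊝-involutive k x

  act-inverseʳ : (g : Dih n) (x : Fin n) → act g (act (inv g) x) ≡ x
  act-inverseʳ (false , k) x = //-rightDividesˡ k x
  act-inverseʳ (true  , k) x = ⊝-involutive k x

  act-· : (g h : Dih n) (x : Fin n) → act (g · h) x ≡ act g (act h x)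
  act-· (false , a) (false , b) x = sym (assoc x b a)
  act-· (false , a) (true  , b) x = xy∙z≈xz∙y b a (⊖ x)
  act-· (true  , a) (false , b) x =
    trans (assoc a (⊖ b) (⊖ x)) (cong (a ⊕_) (trans (⁻¹-∙-comm b x) (cong ⊖_ (comm b x))))
  act-· (true  , a) (true  , b) x =
    trans (x∙yz≈y∙xz x a (⊖ b)) (cong (a ⊕_) (sym (⁻¹-anti-homo‿- b x)))

  inCoset⇔same-image : (σ : Dih n) (i : Fin n) (g : Dih n) → InCoset σ i g ⇔ act g i ≡ act σ i
  inCoset⇔same-image σ i g = mk⇔ to from
    where
    to : InCoset σ i g → act g i ≡ act σ i
    to (h , hi≡i , g≗σh) = trans (g≗σh i) (cong (act σ) hi≡i)
    from : act g i ≡ act σ i → InCoset σ i g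
    from gi≡σi = inv σ · g , fixes , λ x → begin
        act g x                       ≡⟨ act-inverseʳ σ (act g x) ⟨
        act σ (act (inv σ) (act g x)) ≡⟨ cong (act σ) (act-· (inv σ) g x) ⟨
        act σ (act (inv σ · g) x)     ∎
      where
      open ≡-Reasoning
      fixes : act (inv σ · g) i ≡ i
      fixes = begin
        act (inv σ · g) i        ≡⟨ act-· (inv σ) g i ⟩
        act (inv σ) (act g i)    ≡⟨ cong (act (inv σ)) gi≡σi ⟩
        act (inv σ) (act σ i)    ≡⟨ act-inverseˡ σ i ⟩
        i                        ∎

  same-kind-and-image⇒≡ : ∀ {g h : Dih n} x → proj₁ g ≡ proj₁ h → act g x ≡ act h x → g ≡ h
  same-kind-and-image⇒≡ {false , a} {false , b} x refl eq = cong (false ,_) (∙-cancelˡ x a b eq)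
  same-kind-and-image⇒≡ {true  , a} {true  , b} x refl eq = cong (true ,_) (∙-cancelʳ (⊖ x) a b eq)

  intersect⇒same-image : (g h : Dih n) → Intersect g h → ∃[ x ] act g x ≡ act h x
  intersect⇒same-image g h (i , fix) = act (inv h) i , trans fix (sym (act-inverseʳ h i))

  intersect-distinct⇒kinds-differ : (g h : Dih n) → Intersect g h → g ≢ h → proj₁ g ≢ proj₁ h
  intersect-distinct⇒kinds-differ g h g∩h g≢h kg≡kh with intersect⇒same-image g h g∩h
  ... | x , gx≡hx = g≢h (same-kind-and-image⇒≡ x kg≡kh gx≡hx)

  intersecting⇒length≤2 : (F : List (Dih n)) → Unique F → Intersecting F → length F ≤ 2
  intersecting⇒length≤2 []          _ _ = z≤n
  intersecting⇒length≤2 (_ ∷ [])     _ _ = s≤s z≤n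
  intersecting⇒length≤2 (_ ∷ _ ∷ []) _ _ = s≤s (s≤s z≤n)
  intersecting⇒length≤2 (f ∷ g ∷ h ∷ _) ((f≢g ∷ f≢h ∷ _) ∷ (g≢h ∷ _) ∷ _) I = ⊥-elim
    (no-three-distinct-Bool
      (intersect-distinct⇒kinds-differ f g (I f g (here refl) (there (here refl))) f≢g)
      (intersect-distinct⇒kinds-differ f h (I f h (here refl) (there (there (here refl)))) f≢h)
      (intersect-distinct⇒kinds-differ g h (I g h (there (here refl)) (there (there (here refl)))) g≢h))

  ∈-pair⇔same-image : ∀ {g h : Dih n} {x} → proj₁ g ≢ proj₁ h → act g x ≡ act h x →
                      ∀ f → f ∈ g ∷ h ∷ [] ⇔ act f x ≡ act g x
  ∈-pair⇔same-image {g} {h} {x} kg≢kh gx≡hx f = mk⇔ to from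
    where
    to : f ∈ g ∷ h ∷ [] → act f x ≡ act g x
    to (here refl)         = refl
    to (there (here refl)) = sym gx≡hx
    from : act f x ≡ act g x → f ∈ g ∷ h ∷ []
    from fx≡gx with ≢-Bool⇒≡⊎≡ kg≢kh (proj₁ f)
    ... | inj₁ kf≡kg = here (same-kind-and-image⇒≡ x kf≡kg fx≡gx)
    ... | inj₂ kf≡kh = there (here (same-kind-and-image⇒≡ x kf≡kh (trans fx≡gx gx≡hx)))

  intersecting-pair-isStabCoset : (g h : Dih n) → g ≢ h → Intersect g h → IsStabCoset (g ∷ h ∷ [])
  intersecting-pair-isStabCoset g h g≢h g∩h with intersect⇒same-image g h g∩h
  ... | x , gx≡hx = g , x , λ f →
    ⇔.trans (∈-pair⇔same-image (intersect-distinct⇒kinds-differ g h g∩h g≢h) gx≡hx f)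
            (⇔.sym (inCoset⇔same-image g x f))

  -- allFin n unfolds to zero ∷ nonzero, so stabSize zero is the first term of maxStab n
  -- and allDih n is (false , zero) ∷ map (false ,_) nonzero ++ (true , zero) ∷ ….
  2≤maxStab : 2 ≤ maxStab n
  2≤maxStab = ℕ.≤-trans 2≤stabSize-zero (ℕ.m≤m⊔n _ (foldr _⊔_ 0 (map stabSize nonzero)))
    where
    nonzero : List (Fin n)
    nonzero = tabulate Fin.suc
    2≤stabSize-zero : 2 ≤ stabSize {n} zero
    2≤stabSize-zero = 2≤length-filter (λ g → act g zero ≟ zero) {x = false , zero} (⊕-identityʳ zero)
      (lose {x = true , zero} (∈-++⁺ʳ (map (false ,_) nonzero) (here refl)) (⊕-inverseʳ zero))

  intersecting-length≥2⇒isStabCoset : (F : List (Dih n)) → Unique F → Intersecting F →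
                                      2 ≤ length F → IsStabCoset F
  intersecting-length≥2⇒isStabCoset (_ ∷ []) _ _ (s≤s ())
  intersecting-length≥2⇒isStabCoset (g ∷ h ∷ []) ((g≢h ∷ _) ∷ _) I _ =
    intersecting-pair-isStabCoset g h g≢h (I g h (here refl) (there (here refl)))
  intersecting-length≥2⇒isStabCoset F@(_ ∷ _ ∷ _ ∷ _) U I _ with intersecting⇒length≤2 F U I
  ... | s≤s (s≤s ())

  dihedral-strictEKR : StrictEKR n
  dihedral-strictEKR = ekr , strict
    where
    ekr : EKR n
    ekr F U I = ℕ.≤-trans (intersecting⇒length≤2 F U I) 2≤maxStab
    strict : ∀ F → Unique F → Intersecting F → length F ≡ maxStab n → IsStabCoset F
    strict F U I |F|≡max = intersecting-length≥2⇒isStabCoset F U I (subst (2 ≤_) (sym |F|≡max) 2≤maxStab)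

proposition3p1 : ∀ (n : ℕ) → 3 ≤ n → StrictEKR n
proposition3p1 (suc m) _ = dihedral-strictEKR
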